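{- Let $G$ be an undirected graph and let $\mathcal W=\{W_1,\dots,W_s\}$ with $W_i=\{w_i,w'_i\}$, where for each $i$ both vertices of $W_i$ lie in the same connected component of $G$. If $F$ is a partial Steiner forest of $(G,\mathcal W)$, then there is a minimal Steiner forest of $(G,\mathcal W)$ that contains $F$ as a subgraph.
   Context: Subgraphs are identified with their edge sets. A Steiner forest of $(G,\mathcal W)$ is a subgraph of $G$ containing a $w_i$-$w'_i$ path for every $i$; it is minimal if no proper subgraph of it is a Steiner forest of $(G,\mathcal W)$. A partial Steiner forest of $(G,\mathcal W)$ is a forest $F$ in $G$ of the form $F=\bigcup_{\{w_i,w'_i\}\in\mathcal W'}E(P_i)$ for some subfamily $\mathcal W'\subseteq\mathcal W$, where each $P_i$ is a $w_i$-$w'_i$ path in $G$. -}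

module Defs where

open import Data.Nat using (ℕ)
open import Data.Fin using (Fin)
open import Data.Fin.Subset using (Subset; _∈_; _⊆_; _⊂_)
open import Data.Product using (_×_; _,_; Σ; ∃; proj₁; proj₂)
open import Data.Sum using (_⊎_)
open import Data.List using (List; []; _∷_)
open import Data.List.Relation.Unary.All using (All)
open import Data.List.Relation.Unary.Unique.Propositional using (Unique)
open import Data.Empty using (⊥)
open import Relation.Nullary using (¬_)
open import Relation.Binary.PropositionalEquality using (_≡_)
open import Function.Bundles using (_⇔_)
import Data.List.Membership.Propositional

-- A finite undirected (multi)graph: vertices Fin n, edges Fin m,
-- each edge e has an (unordered) pair of endpoints given by ends e.
record Graph : Set where
  field
    n    : ℕ
    m    : ℕ
    ends : Fin m → Fin n × Fin n

module _ (G : Graph) where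
  open Graph G

  Vertex : Set
  Vertex = Fin n

  Edge : Set
  Edge = Fin m

  Joins : Edge → Vertex → Vertex → Set
  Joins e u v = (ends e ≡ (u , v)) ⊎ (ends e ≡ (v , u))

  -- subgraphs are identified with their edge sets
  EdgeSet : Set
  EdgeSet = Subset m

  data Walk : Vertex → Vertex → Set where
    nil  : (v : Vertex) → Walk v v
    cons : (e : Edge) (u v : Vertex) {w : Vertex} → Joins e u v → Walk v w → Walk u w

  vertices : ∀ {u v} → Walk u v → List Vertex
  vertices (nil v) = v ∷ []
  vertices (cons e u v _ p) = u ∷ vertices p

  edges : ∀ {u v} → Walk u v → List Edge
  edges (nil v) = []
  edges (cons e u v _ p) = e ∷ edges p

  tailV : List Vertex → List Vertex
  tailV [] = []
  tailV (_ ∷ xs) = xs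

  IsPath : ∀ {u v} → Walk u v → Set
  IsPath p = Unique (vertices p)

  InSub : EdgeSet → ∀ {u v} → Walk u v → Set
  InSub S p = All (_∈ S) (edges p)

  IsCycle : ∀ {v} → Walk v v → Set
  IsCycle p = (¬ (edges p ≡ [])) × Unique (edges p) × Unique (tailV (vertices p))

  IsForest : EdgeSet → Set
  IsForest S = ∀ v (c : Walk v v) → IsCycle c → InSub S c → ⊥

  SameComponent : Vertex → Vertex → Set
  SameComponent u v = Walk u v

  module _ {s : ℕ} (W : Fin s → Vertex × Vertex) where

    IsSteinerForest : EdgeSet → Set
    IsSteinerForest S = ∀ i → Σ (Walk (proj₁ (W i)) (proj₂ (W i))) λ p → IsPath p × InSub S p

    IsMinimalSteinerForest : EdgeSet → Set
    IsMinimalSteinerForest S = IsSteinerForest S × (∀ T → T ⊂ S → ¬ IsSteinerForest T)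

    IsPartialSteinerForest : EdgeSet → Set
    IsPartialSteinerForest F =
      IsForest F ×
      Σ (Subset s) λ W' →
      Σ ((i : Fin s) → i ∈ W' → Walk (proj₁ (W i)) (proj₂ (W i))) λ P →
        (∀ i (h : i ∈ W') → IsPath (P i h)) ×
        (∀ e → (e ∈ F) ⇔ (∃ λ i → Σ (i ∈ W') λ h → Data.List.Membership.Propositional._∈_ e (edges (P i h))))

module Submission where

-- Start from the whole edge set, which is a Steiner forest because every
-- terminal pair lies in one component, and delete edges outside F one at a
-- time for as long as a Steiner forest remains.  In the resulting S no edge
-- outside F can be deleted.  S is a forest: an edge e ∉ F on a cycle could be
-- bypassed along the rest of the cycle, so S − e would still be Steiner, and
-- a cycle inside F is excluded since F is a forest.  S is minimal: a Steiner
-- forest T ⊊ S misses an edge e of S; if e ∉ F then S − e ⊇ T is Steiner,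
-- and if e ∈ F then e lies on some P_i ⊆ S, and P_i together with the
-- w_i–w'_i path in T closes a cycle of S through e.  The deletions need
-- "is a Steiner forest" to be decidable, which holds because a path uses
-- each of the finitely many edges at most once.

open import Defs
open import Data.Nat using (ℕ; zero; suc; _≤_; _<_; z≤n; s≤s)
open import Data.Nat.Induction using (<-wellFounded)
open import Data.Fin using (Fin; _≟_)
import Data.Fin.Properties as Fin
open import Data.Fin.Subset using (Subset; _∈_; _∉_; _⊆_; _⊂_; _─_; _-_; ⁅_⁆; ⊤; inside; outside; ∣_∣)
open import Data.Fin.Subset.Properties
  using (_∈?_; ∈⊤; x∈⁅x⁆; p─q⊆p; x∈p∧x≢y⇒x∈p-y; x∈p⇒∣p-x∣<∣p∣)
open import Data.Product using (_×_; _,_; Σ; ∃; ∃₂; proj₁; proj₂)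
open import Data.Product.Properties using (≡-dec)
open import Data.Sum using (_⊎_; inj₁; inj₂)
open import Data.List using (List; []; _∷_; length; lookup)
open import Data.List.Relation.Unary.All as All using (All; []; _∷_)
open import Data.List.Relation.Unary.All.Properties using (¬All⇒Any¬; ¬Any⇒All¬)
open import Data.List.Relation.Unary.Any as Any using (here; there)
open import Data.List.Relation.Unary.AllPairs using ([]; _∷_)
open import Data.List.Relation.Unary.Unique.Propositional using (Unique)
open import Data.List.Membership.Propositional using (find) renaming (_∈_ to _∈ˡ_; _∉_ to _∉ˡ_)
open import Data.List.Membership.Propositional.Properties using (∈-lookup)
open import Data.Vec.Base using (_∷_; here; there)
open import Induction.WellFounded using (Acc; acc)
open import Relation.Nullary using (¬_; Dec; yes; no; ¬?; contradiction)
open import Relation.Nullary.Decidable using (map′; _×-dec_; _⊎-dec_)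
open import Relation.Binary.PropositionalEquality using (_≡_; _≢_; refl; sym; trans; cong)
open import Function.Bundles using (Equivalence)

x∈p─q⇒x∉q : ∀ {k} {x : Fin k} (p q : Subset k) → x ∈ p ─ q → x ∉ q
x∈p─q⇒x∉q (inside ∷ p) (outside ∷ q) here ()
x∈p─q⇒x∉q (_ ∷ p) (_ ∷ q) (there x∈p─q) (there x∈q) = x∈p─q⇒x∉q p q x∈p─q x∈q

x∈p-y⇒x≢y : ∀ {k} {p : Subset k} {x y : Fin k} → x ∈ p - y → x ≢ y
x∈p-y⇒x≢y {p = p} {y = y} x∈p-y refl = x∈p─q⇒x∉q p ⁅ y ⁆ x∈p-y (x∈⁅x⁆ y)

lookup-injective : ∀ {A : Set} {xs : List A} → Unique xs → ∀ i j → lookup xs i ≡ lookup xs j → i ≡ j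
lookup-injective (_ ∷ _) Fin.zero Fin.zero _ = refl
lookup-injective (x∉xs ∷ _) Fin.zero (Fin.suc j) eq = contradiction eq (All.lookup x∉xs (∈-lookup j))
lookup-injective (x∉xs ∷ _) (Fin.suc i) Fin.zero eq = contradiction (sym eq) (All.lookup x∉xs (∈-lookup i))
lookup-injective (_ ∷ xs!) (Fin.suc i) (Fin.suc j) eq = cong Fin.suc (lookup-injective xs! i j eq)

p⊆q∧x∉p⇒p⊆q-x : ∀ {k} {p q : Subset k} {x : Fin k} → p ⊆ q → x ∉ p → p ⊆ q - x
p⊆q∧x∉p⇒p⊆q-x p⊆q x∉p y∈p = x∈p∧x≢y⇒x∈p-y (p⊆q y∈p) λ { refl → x∉p y∈p }

unique⇒length≤ : ∀ {k} {xs : List (Fin k)} → Unique xs → length xs ≤ k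
unique⇒length≤ xs! = Fin.injective⇒≤ (λ {i} {j} → lookup-injective xs! i j)

module _ (G : Graph) where
  open Graph G using (m; ends)

  joins-sym : ∀ e {u v} → Joins G e u v → Joins G e v u
  joins-sym e (inj₁ eq) = inj₂ eq
  joins-sym e (inj₂ eq) = inj₁ eq

  joins-same : ∀ e {a b x y} → Joins G e a b → Joins G e x y → (a ≡ x × b ≡ y) ⊎ (a ≡ y × b ≡ x)
  joins-same e (inj₁ p) (inj₁ q) = inj₁ (cong proj₁ (trans (sym p) q) , cong proj₂ (trans (sym p) q))
  joins-same e (inj₁ p) (inj₂ q) = inj₂ (cong proj₁ (trans (sym p) q) , cong proj₂ (trans (sym p) q))
  joins-same e (inj₂ p) (inj₁ q) = inj₂ (cong proj₂ (trans (sym p) q) , cong proj₁ (trans (sym p) q))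
  joins-same e (inj₂ p) (inj₂ q) = inj₁ (cong proj₂ (trans (sym p) q) , cong proj₁ (trans (sym p) q))

  joins? : ∀ e u v → Dec (Joins G e u v)
  joins? e u v = ≡-dec _≟_ _≟_ (ends e) (u , v) ⊎-dec ≡-dec _≟_ _≟_ (ends e) (v , u)

  infixr 5 _++ʷ_

  _++ʷ_ : ∀ {u v w} → Walk G u v → Walk G v w → Walk G u w
  nil _ ++ʷ q = q
  cons e u v j p ++ʷ q = cons e u v j (p ++ʷ q)

  reverseʷ : ∀ {u v} → Walk G u v → Walk G v u
  reverseʷ (nil v) = nil v
  reverseʷ (cons e u v j p) = reverseʷ p ++ʷ cons e v u (joins-sym e j) (nil u)

  All-++ʷ : ∀ {P : Edge G → Set} {u v w} (p : Walk G u v) (q : Walk G v w) →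
    All P (edges G p) → All P (edges G q) → All P (edges G (p ++ʷ q))
  All-++ʷ (nil _) q _ Pq = Pq
  All-++ʷ (cons e u v j p) q (Pe ∷ Pp) Pq = Pe ∷ All-++ʷ p q Pp Pq

  All-reverseʷ : ∀ {P : Edge G → Set} {u v} (p : Walk G u v) → All P (edges G p) → All P (edges G (reverseʷ p))
  All-reverseʷ (nil v) _ = []
  All-reverseʷ (cons e u v j p) (Pe ∷ Pp) = All-++ʷ (reverseʷ p) _ (All-reverseʷ p Pp) (Pe ∷ [])

  InSub-minus : ∀ {S e u w} {p : Walk G u w} → InSub G S p → e ∉ˡ edges G p → InSub G (S - e) p
  InSub-minus p⊆S e∉p = All.tabulate λ f∈p →
    x∈p∧x≢y⇒x∈p-y (All.lookup p⊆S f∈p) λ { refl → e∉p f∈p }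

  head∈vertices : ∀ {v w} (p : Walk G v w) → v ∈ˡ vertices G p
  head∈vertices (nil v) = here refl
  head∈vertices (cons e u v j p) = here refl

  joins⇒∈vertices : ∀ {f u x a w} (p : Walk G a w) → Joins G f u x → f ∈ˡ edges G p → u ∈ˡ vertices G p
  joins⇒∈vertices (cons f a b jf p) j (here refl) with joins-same f j jf
  ... | inj₁ (refl , _) = here refl
  ... | inj₂ (refl , _) = there (head∈vertices p)
  joins⇒∈vertices (cons g a b _ p) j (there f∈p) = there (joins⇒∈vertices p j f∈p)

  fresh⇒∉edges : ∀ {f u x a w} (p : Walk G a w) → Joins G f u x → All (u ≢_) (vertices G p) → f ∉ˡ edges G p
  fresh⇒∉edges p j u∉p f∈p = All.lookup u∉p (joins⇒∈vertices p j f∈p) refl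

  path⇒unique-edges : ∀ {u w} (p : Walk G u w) → IsPath G p → Unique (edges G p)
  path⇒unique-edges (nil v) _ = []
  path⇒unique-edges (cons f u v j p) (u∉p ∷ p!) =
    All.tabulate (λ { g∈p refl → fresh⇒∉edges p j u∉p g∈p }) ∷ path⇒unique-edges p p!

  path-length≤ : ∀ {u w} (p : Walk G u w) → IsPath G p → length (edges G p) ≤ m
  path-length≤ p p! = unique⇒length≤ (path⇒unique-edges p p!)

  PathIn : EdgeSet G → Vertex G → Vertex G → Set
  PathIn S u w = Σ (Walk G u w) λ p → IsPath G p × InSub G S p

  suffix-from : ∀ {S x w u} (p : Walk G x w) → u ∈ˡ vertices G p → IsPath G p → InSub G S p → PathIn S u w
  suffix-from (nil v) (here refl) p! p⊆S = nil v , p! , p⊆S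
  suffix-from (cons e x v j p) (here refl) p! p⊆S = cons e x v j p , p! , p⊆S
  suffix-from (cons e x v j p) (there u∈p) (_ ∷ p!) (_ ∷ p⊆S) = suffix-from p u∈p p! p⊆S

  walk⇒path : ∀ {S u w} (p : Walk G u w) → InSub G S p → PathIn S u w
  walk⇒path (nil v) _ = nil v , [] ∷ [] , []
  walk⇒path (cons e u v j p) (e∈S ∷ p⊆S) with walk⇒path p p⊆S
  ... | q , q! , q⊆S with Any.any? (u ≟_) (vertices G q)
  ...   | yes u∈q = suffix-from q u∈q q! q⊆S
  ...   | no u∉q = cons e u v j q , ¬Any⇒All¬ _ u∉q ∷ q! , e∈S ∷ q⊆S

  -- e lies on a cycle of S
  Detour : EdgeSet G → Edge G → Set
  Detour S e = ∃₂ λ x y → Joins G e x y × Σ (Walk G y x) (InSub G (S - e))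

  split-at : ∀ {S e u w} (c : Walk G u w) → Unique (edges G c) → InSub G S c → e ∈ˡ edges G c →
    ∃₂ λ x y → Joins G e x y × Σ (Walk G u x) (InSub G (S - e)) × Σ (Walk G y w) (InSub G (S - e))
  split-at (cons f u v j c) (f∉c ∷ _) (_ ∷ c⊆S) (here refl) =
    u , v , j , (nil u , []) , (c , InSub-minus c⊆S λ f∈c → All.lookup f∉c f∈c refl)
  split-at (cons f u v j c) (f∉c ∷ c!) (f∈S ∷ c⊆S) (there e∈c) with split-at c c! c⊆S e∈c
  ... | x , y , j′ , (b , b⊆) , a =
    x , y , j′ , (cons f u v j b , x∈p∧x≢y⇒x∈p-y f∈S (All.lookup f∉c e∈c) ∷ b⊆) , a

  cycle⇒detour : ∀ {S e v} (c : Walk G v v) → IsCycle G c → InSub G S c → e ∈ˡ edges G c → Detour S e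
  cycle⇒detour c (_ , c! , _) c⊆S e∈c with split-at c c! c⊆S e∈c
  ... | x , y , j , (b , b⊆) , (a , a⊆) = x , y , j , a ++ʷ b , All-++ʷ a b a⊆ b⊆

  path-detour : ∀ {S e u w} (p : Walk G u w) → IsPath G p → InSub G S p → e ∈ˡ edges G p →
    (q : Walk G u w) → InSub G (S - e) q → Detour S e
  path-detour (cons e u v j p) (u∉p ∷ _) (_ ∷ p⊆S) (here refl) q q⊆S-e =
    u , v , j , p ++ʷ reverseʷ q ,
    All-++ʷ p _ (InSub-minus p⊆S (fresh⇒∉edges p j u∉p)) (All-reverseʷ q q⊆S-e)
  path-detour (cons f u v j p) (u∉p ∷ p!) (f∈S ∷ p⊆S) (there e∈p) q q⊆S-e =
    path-detour p p! p⊆S e∈p (cons f v u (joins-sym f j) q)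
      (x∈p∧x≢y⇒x∈p-y f∈S (λ { refl → fresh⇒∉edges p j u∉p e∈p }) ∷ q⊆S-e)

  detour⇒¬forest : ∀ {S e} → IsForest G S → e ∈ S → ¬ Detour S e
  detour⇒¬forest {e = e} S-forest e∈S (x , y , j , d , d⊆) with walk⇒path d d⊆
  ... | p , p! , p⊆ =
    S-forest x (cons e x y j p)
      ((λ ()) , All.map (λ f∈ e≡f → x∈p-y⇒x≢y f∈ (sym e≡f)) p⊆ ∷ path⇒unique-edges p p! , p!)
      (e∈S ∷ All.map (p─q⊆p _ _) p⊆)

  reroute : ∀ {S e} → Detour S e → ∀ {u w} (p : Walk G u w) → InSub G S p → Σ (Walk G u w) (InSub G (S - e))
  reroute _ (nil v) _ = nil v , []
  reroute {e = e} δ@(x , y , j , d , d⊆) (cons f a b jf p) (f∈S ∷ p⊆S) with reroute δ p p⊆S | f ≟ e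
  ... | r , r⊆ | no f≢e = cons f a b jf r , x∈p∧x≢y⇒x∈p-y f∈S f≢e ∷ r⊆
  ... | r , r⊆ | yes refl with joins-same f jf j
  ...   | inj₁ (refl , refl) = reverseʷ d ++ʷ r , All-++ʷ (reverseʷ d) r (All-reverseʷ d d⊆) r⊆
  ...   | inj₂ (refl , refl) = d ++ʷ r , All-++ʷ d r d⊆ r⊆

  Reach : EdgeSet G → ℕ → Vertex G → Vertex G → Set
  Reach T k u v = Σ (Walk G u v) λ p → InSub G T p × length (edges G p) ≤ k

  reach? : ∀ T k u v → Dec (Reach T k u v)
  reach? T zero u v = map′ (λ { refl → nil u , [] , z≤n }) (λ { (nil _ , _) → refl ; (cons _ _ _ _ _ , _ , ()) }) (u ≟ v)
  reach? T (suc k) u v = map′ extend unextend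
    (u ≟ v ⊎-dec Fin.any? λ e → Fin.any? λ x → e ∈? T ×-dec joins? e u x ×-dec reach? T k x v)
    where
    extend : u ≡ v ⊎ (∃₂ λ e x → e ∈ T × Joins G e u x × Reach T k x v) → Reach T (suc k) u v
    extend (inj₁ refl) = nil u , [] , z≤n
    extend (inj₂ (e , x , e∈T , j , p , p⊆T , |p|≤k)) = cons e u x j p , e∈T ∷ p⊆T , s≤s |p|≤k
    unextend : Reach T (suc k) u v → u ≡ v ⊎ (∃₂ λ e x → e ∈ T × Joins G e u x × Reach T k x v)
    unextend (nil _ , _) = inj₁ refl
    unextend (cons e _ x j p , e∈T ∷ p⊆T , s≤s |p|≤k) = inj₂ (e , x , e∈T , j , p , p⊆T , |p|≤k)

  module _ {s} (W : Fin s → Vertex G × Vertex G) where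

    steiner? : ∀ T → Dec (IsSteinerForest G W T)
    steiner? T = map′ (λ reach i → reachable⇒path (reach i)) (λ st i → path⇒reachable (st i))
      (Fin.all? λ i → reach? T m (proj₁ (W i)) (proj₂ (W i)))
      where
      reachable⇒path : ∀ {u v} → Reach T m u v → PathIn T u v
      reachable⇒path (p , p⊆T , _) = walk⇒path p p⊆T
      path⇒reachable : ∀ {u v} → PathIn T u v → Reach T m u v
      path⇒reachable (p , p! , p⊆T) = p , p⊆T , path-length≤ p p!

    steiner-mono : ∀ {T T′} → T ⊆ T′ → IsSteinerForest G W T → IsSteinerForest G W T′
    steiner-mono T⊆T′ st i = let (p , p! , p⊆T) = st i in p , p! , All.map T⊆T′ p⊆T

    detour⇒steiner-minus : ∀ {S e} → Detour S e → IsSteinerForest G W S → IsSteinerForest G W (S - e)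
    detour⇒steiner-minus δ st i =
      let (p , _ , p⊆S) = st i ; (r , r⊆) = reroute δ p p⊆S in walk⇒path r r⊆

    module _ (F : EdgeSet G) where

      Reduced : EdgeSet G → Set
      Reduced S = ∀ {e} → e ∈ S → e ∉ F → ¬ IsSteinerForest G W (S - e)

      reduce : ∀ S → Acc _<_ ∣ S ∣ → IsSteinerForest G W S → F ⊆ S →
        Σ (EdgeSet G) λ S′ → IsSteinerForest G W S′ × F ⊆ S′ × Reduced S′
      reduce S (acc smaller) st F⊆S with Fin.any? (λ e → e ∈? S ×-dec ¬? (e ∈? F) ×-dec steiner? (S - e))
      ... | yes (e , e∈S , e∉F , st-e) =
        reduce (S - e) (smaller (x∈p⇒∣p-x∣<∣p∣ e∈S)) st-e (p⊆q∧x∉p⇒p⊆q-x F⊆S e∉F)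
      ... | no stuck = S , st , F⊆S , λ e∈S e∉F st-e → stuck (_ , e∈S , e∉F , st-e)

      reduced⇒forest : ∀ {S} → IsForest G F → IsSteinerForest G W S → Reduced S → IsForest G S
      reduced⇒forest F-forest st red v c c-cycle c⊆S with All.all? (_∈? F) (edges G c)
      ... | yes c⊆F = F-forest v c c-cycle c⊆F
      ... | no c⊈F with find (¬All⇒Any¬ (_∈? F) (edges G c) c⊈F)
      ...   | e , e∈c , e∉F =
        red (All.lookup c⊆S e∈c) e∉F (detour⇒steiner-minus (cycle⇒detour c c-cycle c⊆S e∈c) st)

      EdgesOnTerminalPaths : EdgeSet G → Set
      EdgesOnTerminalPaths S =
        ∀ {e} → e ∈ F → ∃ λ i → Σ (PathIn S (proj₁ (W i)) (proj₂ (W i))) λ P → e ∈ˡ edges G (proj₁ P)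

      partial⇒edgesOnTerminalPaths : ∀ {S} → IsPartialSteinerForest G W F → F ⊆ S → EdgesOnTerminalPaths S
      partial⇒edgesOnTerminalPaths (_ , _ , P , P-path , F⇔⋃P) F⊆S e∈F =
        let (i , h , e∈P) = Equivalence.to (F⇔⋃P _) e∈F in
        i , (P i h , P-path i h , All.tabulate λ f∈P → F⊆S (Equivalence.from (F⇔⋃P _) (i , h , f∈P))) , e∈P

      reduced⇒minimal : ∀ {S} → IsForest G S → IsSteinerForest G W S → Reduced S →
        EdgesOnTerminalPaths S → IsMinimalSteinerForest G W S
      reduced⇒minimal {S} S-forest st red F-on-paths = st , minimal
        where
        minimal : ∀ T → T ⊂ S → ¬ IsSteinerForest G W T
        minimal T (T⊆S , e , e∈S , e∉T) st-T with e ∈? F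
        ... | no e∉F = red e∈S e∉F (steiner-mono (p⊆q∧x∉p⇒p⊆q-x T⊆S e∉T) st-T)
        ... | yes e∈F with F-on-paths e∈F
        ...   | i , (p , p! , p⊆S) , e∈p =
          let (q , _ , q⊆T) = st-T i in
          detour⇒¬forest S-forest e∈S (path-detour p p! p⊆S e∈p q (All.map (p⊆q∧x∉p⇒p⊆q-x T⊆S e∉T) q⊆T))

lemma5p2 : (G : Graph) {s : ℕ} (W : Fin s → Vertex G × Vertex G) →
    (∀ i → SameComponent G (proj₁ (W i)) (proj₂ (W i))) →
    (F : EdgeSet G) → IsPartialSteinerForest G W F →
    Σ (EdgeSet G) λ S → IsMinimalSteinerForest G W S × F ⊆ S
lemma5p2 G W connected F F-partial@(F-forest , _) =
  let (S , S-steiner , F⊆S , S-reduced) = reduce G W F ⊤ (<-wellFounded _) ⊤-steiner (λ _ → ∈⊤) in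
  S ,
  reduced⇒minimal G W F (reduced⇒forest G W F F-forest S-steiner S-reduced) S-steiner S-reduced
    (partial⇒edgesOnTerminalPaths G W F F-partial F⊆S) ,
  F⊆S
  where
  ⊤-steiner : IsSteinerForest G W ⊤
  ⊤-steiner i = walk⇒path G (connected i) (All.tabulate λ _ → ∈⊤)
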